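{- For all integers $n$, $$\det\begin{pmatrix} f(n,x,s)^2 & f(n-1,x,qs)^2 & f(n-2,x,q^2s)^2\\ f(n+1,x,s)^2 & f(n,x,qs)^2 & f(n-1,x,q^2s)^2\\ f(n+2,x,s)^2 & f(n+1,x,qs)^2 & f(n,x,q^2s)^2\end{pmatrix}=2(-1)^n x^2 s^{3n-4}q^{\frac{(n+1)(3n-4)}{2}} .$$
   Context: The (Carlitz) $q$-Fibonacci polynomials $f(n,x,s)$ are defined by $f(n,x,s)=xf(n-1,x,s)+q^{n-2}sf(n-2,x,s)$ with $f(0,x,s)=0$, $f(1,x,s)=1$. The same recurrence, run backwards, extends the definition to all integers $n$ (the values are then rational functions in $x,s,q$); the recurrence holds for all $n\in\mathbb{Z}$. -}

module Defs where

open import Level using (Level)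
open import Data.Nat as ℕ using (ℕ; zero; suc)
open import Data.Integer as ℤ using (ℤ; +_; -[1+_])
open import Data.Product using (_×_; _,_; proj₁)
open import Algebra.Bundles using (CommutativeRing)

-- Everything is carried out in an arbitrary commutative ring R in which
-- q and s are units (their inverses qi, si are given explicitly).
-- Negative-index values of f only involve denominators that are monomials
-- in q and s, so this is the natural home of the identity (taking R to be
-- the field of rational functions Q(x,s,q) recovers the paper's setting).
module QFib {c ℓ : Level} (R : CommutativeRing c ℓ) where
  open CommutativeRing R

  pow : Carrier → ℕ → Carrier
  pow a zero = 1#
  pow a (suc k) = a * pow a k

  zpow : Carrier → Carrier → ℤ → Carrier
  zpow a ai (+ k) = pow a k
  zpow a ai -[1+ k ] = pow ai (suc k)

  -- nonnegative part: (f(n), f(n+1)) for n ≥ 0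
  fPos : Carrier → Carrier → Carrier → ℕ → Carrier × Carrier
  fPos q x s zero = 0# , 1#
  fPos q x s (suc n) with fPos q x s n
  ... | (a , b) = b , (x * b + pow q n * s * a)

  -- nonpositive part: (f(-m), f(1-m)) for m ≥ 0, using the recurrence
  -- backwards: f(n-2) = (f(n) - x f(n-1)) / (q^(n-2) s); with n = 1-m
  -- this gives f(-m-1) = (f(1-m) - x f(-m)) * q^(m+1) * s⁻¹.
  fNeg : Carrier → Carrier → Carrier → Carrier → ℕ → Carrier × Carrier
  fNeg q x s si zero = 0# , 1#
  fNeg q x s si (suc m) with fNeg q x s si m
  ... | (a , b) = ((b - x * a) * pow q (suc m) * si) , a

  f : (q : Carrier) → ℤ → (x s si : Carrier) → Carrier
  f q (+ n) x s si = proj₁ (fPos q x s n)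
  f q -[1+ m ] x s si = proj₁ (fNeg q x s si (suc m))

  det3 : (a b c d e g h i j : Carrier) → Carrier
  det3 a b c d e g h i j =
    a * (e * j - g * i) - b * (d * j - g * h) + c * (d * i - e * h)

  sq : Carrier → Carrier
  sq a = a * a

-- Column j of the matrix is the sequence m ↦ f(m − j, x, q^j s). Since
-- q^(m−j) · q^j s = q^m s, the three columns solve one and the same recurrence
-- y(m+2) = x y(m+1) + τ(m) y(m) with τ(m) = q^m s, so the determinant is the
-- Casoratian of the squares of three solutions. For such squares the Casoratian
-- satisfies W(m+1) = −τ(m+1) τ(m)² W(m), a polynomial identity. The right-hand
-- side obeys the same first-order recurrence and both sides agree at n = 2;
-- since τ(m) is a unit the recurrence runs in both directions, so they agree
-- on all of ℤ.
module Submission where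

open import Defs
open import Level using (Level; _⊔_)
open import Data.Nat as ℕ using (ℕ; zero; suc)
open import Data.Integer as ℤ using (ℤ; +_; -[1+_]; _/ℕ_; _%ℕ_)
open import Data.Integer.DivMod
  using (_/_; a≡a%ℕn+[a/ℕn]*n; div-pos-is-/ℕ; n%ℕd<d; [n/ℕd]*d≤n; n<s[n/ℕd]*d)
import Data.Integer.Properties as ℤ
open import Data.Integer.Tactic.RingSolver using (solve-∀)
open import Data.Product using (_,_; proj₁; proj₂)
open import Function using (_∘_)
open import Algebra.Bundles using (CommutativeRing)
open import Relation.Binary.PropositionalEquality as Eq using (_≡_; cong; subst; module ≡-Reasoning)

ℤ-bi-induction : ∀ {p} (P : ℤ → Set p) →
                 (∀ i → P i → P (ℤ.suc i)) → (∀ i → P (ℤ.suc i) → P i) →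
                 ∀ i → P i → ∀ j → P j
ℤ-bi-induction P up down i pᵢ j = fromZero j (toZero i pᵢ)
  where
  toZero : ∀ i → P i → P (+ 0)
  toZero (+ zero)        p = p
  toZero (+ suc n)       p = toZero (+ n) (down (+ n) p)
  toZero -[1+ zero ]     p = up -[1+ zero ] p
  toZero -[1+ suc n ]    p = toZero -[1+ n ] (up -[1+ suc n ] p)

  fromZero : ∀ j → P (+ 0) → P j
  fromZero (+ zero)      p = p
  fromZero (+ suc n)     p = up (+ n) (fromZero (+ n) p)
  fromZero -[1+ zero ]   p = down -[1+ zero ] p
  fromZero -[1+ suc n ]  p = down -[1+ suc n ] (fromZero -[1+ n ] p)

i<suc[j]⇒i≤j : ∀ {i j} → i ℤ.< ℤ.suc j → i ℤ.≤ j
i<suc[j]⇒i≤j {i} {j} i<j+1 = subst (i ℤ.≤_) (ℤ.pred-suc j) (ℤ.i<j⇒i≤pred[j] i<j+1)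

/ℕ-unique : ∀ {i m : ℤ} {r d : ℕ} .{{_ : ℕ.NonZero d}} →
            r ℕ.< d → i ≡ + r ℤ.+ m ℤ.* + d → i /ℕ d ≡ m
/ℕ-unique {i} {m} {r} {d} r<d Eq.refl = ℤ.≤-antisym (i<suc[j]⇒i≤j k<1+m) (i<suc[j]⇒i≤j m<1+k)
  where
  open ℤ.≤-Reasoning
  k = i /ℕ d
  k<1+m : k ℤ.< ℤ.suc m
  k<1+m = ℤ.*-cancelʳ-<-nonNeg (+ d) (begin-strict
    k ℤ.* + d                ≤⟨ [n/ℕd]*d≤n i d ⟩
    + r ℤ.+ m ℤ.* + d        <⟨ ℤ.+-monoˡ-< (m ℤ.* + d) (ℤ.+<+ r<d) ⟩
    + d ℤ.+ m ℤ.* + d        ≡⟨ ℤ.suc-* m (+ d) ⟨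
    ℤ.suc m ℤ.* + d          ∎)
  m<1+k : m ℤ.< ℤ.suc k
  m<1+k = ℤ.*-cancelʳ-<-nonNeg (+ d) (begin-strict
    m ℤ.* + d                ≤⟨ ℤ.i≤j+i (m ℤ.* + d) (+ r) ⟩
    + r ℤ.+ m ℤ.* + d        <⟨ n<s[n/ℕd]*d i d ⟩
    ℤ.suc k ℤ.* + d          ∎)

[i+j*d]/d≡i/d+j : ∀ i j d .{{_ : ℕ.NonZero d}} → (i ℤ.+ j ℤ.* + d) / + d ≡ i / + d ℤ.+ j
[i+j*d]/d≡i/d+j i j d = begin
  (i ℤ.+ j ℤ.* + d) / + d  ≡⟨ div-pos-is-/ℕ (i ℤ.+ j ℤ.* + d) d ⟩
  (i ℤ.+ j ℤ.* + d) /ℕ d   ≡⟨ /ℕ-unique (n%ℕd<d i d) decomposition ⟩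
  i /ℕ d ℤ.+ j             ≡⟨ cong (ℤ._+ j) (div-pos-is-/ℕ i d) ⟨
  i / + d ℤ.+ j            ∎
  where
  open ≡-Reasoning
  decomposition : i ℤ.+ j ℤ.* + d ≡ + (i %ℕ d) ℤ.+ (i /ℕ d ℤ.+ j) ℤ.* + d
  decomposition = begin
    i ℤ.+ j ℤ.* + d                               ≡⟨ cong (ℤ._+ j ℤ.* + d) (a≡a%ℕn+[a/ℕn]*n i d) ⟩
    + (i %ℕ d) ℤ.+ i /ℕ d ℤ.* + d ℤ.+ j ℤ.* + d   ≡⟨ ℤ.+-assoc (+ (i %ℕ d)) (i /ℕ d ℤ.* + d) (j ℤ.* + d) ⟩
    + (i %ℕ d) ℤ.+ (i /ℕ d ℤ.* + d ℤ.+ j ℤ.* + d) ≡⟨ cong (ℤ._+_ (+ (i %ℕ d))) (ℤ.*-distribʳ-+ (+ d) (i /ℕ d) j) ⟨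
    + (i %ℕ d) ℤ.+ (i /ℕ d ℤ.+ j) ℤ.* + d         ∎

exponent-suc : ∀ n →
  ((ℤ.suc n ℤ.+ + 1) ℤ.* (+ 3 ℤ.* ℤ.suc n ℤ.- + 4)) / + 2
    ≡ ((n ℤ.+ + 1) ℤ.* (+ 3 ℤ.* n ℤ.- + 4)) / + 2 ℤ.+ ℤ.suc (n ℤ.+ (n ℤ.+ n))
exponent-suc n =
  Eq.trans (cong (_/ + 2) (numerator n)) ([i+j*d]/d≡i/d+j product (ℤ.suc (n ℤ.+ (n ℤ.+ n))) 2)
  where
  product = (n ℤ.+ + 1) ℤ.* (+ 3 ℤ.* n ℤ.- + 4)
  numerator : ∀ n → (+ 1 ℤ.+ n ℤ.+ + 1) ℤ.* (+ 3 ℤ.* (+ 1 ℤ.+ n) ℤ.- + 4)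
                  ≡ (n ℤ.+ + 1) ℤ.* (+ 3 ℤ.* n ℤ.- + 4) ℤ.+ (+ 1 ℤ.+ (n ℤ.+ (n ℤ.+ n))) ℤ.* + 2
  numerator = solve-∀

module _ {r ℓ : Level} (R : CommutativeRing r ℓ) where
  open CommutativeRing R
  open QFib R
  open import Algebra.Definitions _≈_ using (RightInvertible)
  open import Algebra.Properties.Ring ring
    using ( -1*x≈-x; -‿distribˡ-*; -‿distribʳ-*; -‿involutive; -‿+-comm
          ; x[y-z]≈xy-xz; ⁻¹-anti-homo‿-; x≈z//y; //-rightDividesˡ )
  open import Algebra.Properties.CommutativeSemigroup +-commutativeSemigroup using (interchange)
  open import Algebra.Properties.CommutativeSemigroup *-commutativeSemigroup
    using (xy∙z≈y∙xz; x∙yz≈y∙xz) renaming (interchange to *-interchange)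
  open import Algebra.Solver.Ring.NaturalCoefficients.Default commutativeSemiring
  open import Relation.Binary.Reasoning.Setoid setoid

  IsUnit : Carrier → Set (r ⊔ ℓ)
  IsUnit = RightInvertible 1# _*_

  *-inverse : ∀ {a a′ b b′} → a * a′ ≈ 1# → b * b′ ≈ 1# → a * b * (a′ * b′) ≈ 1#
  *-inverse {a} {a′} {b} {b′} aa′≈1 bb′≈1 = begin
    a * b * (a′ * b′)  ≈⟨ *-interchange a b a′ b′ ⟩
    a * a′ * (b * b′)  ≈⟨ *-cong aa′≈1 bb′≈1 ⟩
    1# * 1#            ≈⟨ *-identityˡ 1# ⟩
    1#                 ∎

  *-unit : ∀ {a b} → IsUnit a → IsUnit b → IsUnit (a * b)
  *-unit (a⁻¹ , aa⁻¹≈1) (b⁻¹ , bb⁻¹≈1) = a⁻¹ * b⁻¹ , *-inverse aa⁻¹≈1 bb⁻¹≈1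

  -‿unit : ∀ {a} → IsUnit a → IsUnit (- a)
  -‿unit {a} (a⁻¹ , aa⁻¹≈1) = - a⁻¹ , (begin
    - a * - a⁻¹      ≈⟨ -‿distribˡ-* a (- a⁻¹) ⟨
    - (a * - a⁻¹)    ≈⟨ -‿cong (-‿distribʳ-* a a⁻¹) ⟨
    - - (a * a⁻¹)    ≈⟨ -‿involutive (a * a⁻¹) ⟩
    a * a⁻¹          ≈⟨ aa⁻¹≈1 ⟩
    1#               ∎)

  *-cancelˡ-unit : ∀ {a x y} → IsUnit a → a * x ≈ a * y → x ≈ y
  *-cancelˡ-unit {a} {x} {y} (a⁻¹ , aa⁻¹≈1) ax≈ay = begin
    x                ≈⟨ *-identityˡ x ⟨
    1# * x           ≈⟨ *-congʳ aa⁻¹≈1 ⟨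
    a * a⁻¹ * x      ≈⟨ xy∙z≈y∙xz a a⁻¹ x ⟩
    a⁻¹ * (a * x)    ≈⟨ *-congˡ ax≈ay ⟩
    a⁻¹ * (a * y)    ≈⟨ xy∙z≈y∙xz a a⁻¹ y ⟨
    a * a⁻¹ * y      ≈⟨ *-congʳ aa⁻¹≈1 ⟩
    1# * y           ≈⟨ *-identityˡ y ⟩
    y                ∎

  same-ratio⇒≈ : ∀ {A B κ : ℤ → Carrier} → (∀ i → IsUnit (κ i)) →
                 (∀ i → A (ℤ.suc i) ≈ κ i * A i) → (∀ i → B (ℤ.suc i) ≈ κ i * B i) →
                 ∀ i₀ → A i₀ ≈ B i₀ → ∀ i → A i ≈ B i
  same-ratio⇒≈ {A} {B} {κ} κ-unit A-suc B-suc =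
    ℤ-bi-induction (λ i → A i ≈ B i) up down
    where
    up : ∀ i → A i ≈ B i → A (ℤ.suc i) ≈ B (ℤ.suc i)
    up i eq = trans (A-suc i) (trans (*-congˡ eq) (sym (B-suc i)))
    down : ∀ i → A (ℤ.suc i) ≈ B (ℤ.suc i) → A i ≈ B i
    down i eq = *-cancelˡ-unit (κ-unit i) (trans (sym (A-suc i)) (trans eq (B-suc i)))

  pow-inverse : ∀ {a b} → a * b ≈ 1# → ∀ n → pow a n * pow b n ≈ 1#
  pow-inverse ab≈1 zero    = *-identityˡ 1#
  pow-inverse ab≈1 (suc n) = *-inverse ab≈1 (pow-inverse ab≈1 n)

  module _ {a a⁻¹ : Carrier} (aa⁻¹≈1 : a * a⁻¹ ≈ 1#) where

    private
      cancel : ∀ x → a * (a⁻¹ * x) ≈ x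
      cancel x = trans (sym (*-assoc a a⁻¹ x)) (trans (*-congʳ aa⁻¹≈1) (*-identityˡ x))

    zpow-suc : ∀ i → zpow a a⁻¹ (ℤ.suc i) ≈ a * zpow a a⁻¹ i
    zpow-suc (+ n)           = refl
    zpow-suc -[1+ zero ]     = sym (cancel 1#)
    zpow-suc -[1+ suc n ]    = sym (cancel (pow a⁻¹ (suc n)))

    zpow-unit : ∀ i → IsUnit (zpow a a⁻¹ i)
    zpow-unit (+ n)        = pow a⁻¹ n , pow-inverse aa⁻¹≈1 n
    zpow-unit -[1+ n ]     = pow a (suc n) , pow-inverse (trans (*-comm a⁻¹ a) aa⁻¹≈1) (suc n)

    zpow-+ : ∀ i j → zpow a a⁻¹ (i ℤ.+ j) ≈ zpow a a⁻¹ i * zpow a a⁻¹ j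
    zpow-+ i = same-ratio⇒≈ (λ _ → a⁻¹ , aa⁻¹≈1) left-suc right-suc (+ 0) base
      where
      i+suc[j]≡suc[i+j] : ∀ i j → i ℤ.+ (+ 1 ℤ.+ j) ≡ + 1 ℤ.+ (i ℤ.+ j)
      i+suc[j]≡suc[i+j] = solve-∀
      left-suc : ∀ j → zpow a a⁻¹ (i ℤ.+ ℤ.suc j) ≈ a * zpow a a⁻¹ (i ℤ.+ j)
      left-suc j = trans (reflexive (Eq.cong (zpow a a⁻¹) (i+suc[j]≡suc[i+j] i j))) (zpow-suc (i ℤ.+ j))
      right-suc : ∀ j → zpow a a⁻¹ i * zpow a a⁻¹ (ℤ.suc j) ≈ a * (zpow a a⁻¹ i * zpow a a⁻¹ j)
      right-suc j = trans (*-congˡ (zpow-suc j)) (x∙yz≈y∙xz (zpow a a⁻¹ i) a (zpow a a⁻¹ j))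
      base : zpow a a⁻¹ (i ℤ.+ + 0) ≈ zpow a a⁻¹ i * 1#
      base = trans (reflexive (Eq.cong (zpow a a⁻¹) (ℤ.+-identityʳ i))) (sym (*-identityʳ _))

    zpow-pred : ∀ i → zpow a a⁻¹ (i ℤ.- + 1) * a ≈ zpow a a⁻¹ i
    zpow-pred i = begin
      zpow a a⁻¹ (i ℤ.- + 1) * a              ≈⟨ *-comm _ a ⟩
      a * zpow a a⁻¹ (i ℤ.- + 1)              ≈⟨ zpow-suc (i ℤ.- + 1) ⟨
      zpow a a⁻¹ (ℤ.suc (i ℤ.- + 1))          ≡⟨ Eq.cong (zpow a a⁻¹) (suc[i-1]≡i i) ⟩
      zpow a a⁻¹ i                            ∎
      where
      suc[i-1]≡i : ∀ i → + 1 ℤ.+ (i ℤ.- + 1) ≡ i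
      suc[i-1]≡i = solve-∀

  Solves : Carrier → (ℤ → Carrier) → (ℤ → Carrier) → Set ℓ
  Solves x τ y = ∀ m → y (ℤ.suc (ℤ.suc m)) ≈ x * y (ℤ.suc m) + τ m * y m

  Solves-shift : ∀ {x τ y} d → Solves x τ y → Solves x (λ m → τ (m ℤ.+ d)) (λ m → y (m ℤ.+ d))
  Solves-shift {x} {τ} {y} d solves m = begin
    y (ℤ.suc (ℤ.suc m) ℤ.+ d)                            ≡⟨ Eq.cong y (suc-+ (ℤ.suc m)) ⟩
    y (ℤ.suc (ℤ.suc m ℤ.+ d))                            ≡⟨ Eq.cong (y ∘ ℤ.suc) (suc-+ m) ⟩
    y (ℤ.suc (ℤ.suc (m ℤ.+ d)))                          ≈⟨ solves (m ℤ.+ d) ⟩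
    x * y (ℤ.suc (m ℤ.+ d)) + rest                        ≡⟨ Eq.cong (λ i → x * y i + rest) (suc-+ m) ⟨
    x * y (ℤ.suc m ℤ.+ d) + rest                          ∎
    where
    rest = τ (m ℤ.+ d) * y (m ℤ.+ d)
    suc-+ : ∀ i → ℤ.suc i ℤ.+ d ≡ ℤ.suc (i ℤ.+ d)
    suc-+ i = ℤ.+-assoc (+ 1) i d

  Solves-coeff : ∀ {x τ τ′ y} → (∀ m → τ m ≈ τ′ m) → Solves x τ y → Solves x τ′ y
  Solves-coeff τ≈τ′ solves m = trans (solves m) (+-congˡ (*-congʳ (τ≈τ′ m)))

  module _ {q q⁻¹ S S⁻¹ : Carrier} (x : Carrier) (qq⁻¹≈1 : q * q⁻¹ ≈ 1#) (SS⁻¹≈1 : S * S⁻¹ ≈ 1#) where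

    private
      f-suc-neg : ∀ k → f q (ℤ.suc -[1+ k ]) x S S⁻¹ ≡ proj₁ (fNeg q x S S⁻¹ k)
      f-suc-neg zero    = Eq.refl
      f-suc-neg (suc k) = Eq.refl

      f-suc-suc-neg : ∀ k → f q (ℤ.suc (ℤ.suc -[1+ k ])) x S S⁻¹ ≡ proj₂ (fNeg q x S S⁻¹ k)
      f-suc-suc-neg zero          = Eq.refl
      f-suc-suc-neg (suc zero)    = Eq.refl
      f-suc-suc-neg (suc (suc k)) = Eq.refl

      backward : ∀ {Q Q⁻¹} → Q⁻¹ * Q ≈ 1# → ∀ a b → b ≈ x * a + Q⁻¹ * S * ((b - x * a) * Q * S⁻¹)
      backward {Q} {Q⁻¹} Q⁻¹Q≈1 a b = sym (begin
        x * a + Q⁻¹ * S * ((b - x * a) * Q * S⁻¹)  ≈⟨ +-congˡ (regroup Q⁻¹ Q S S⁻¹ (b - x * a)) ⟩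
        x * a + Q⁻¹ * Q * (S * S⁻¹) * (b - x * a)  ≈⟨ +-congˡ (*-congʳ (*-cong Q⁻¹Q≈1 SS⁻¹≈1)) ⟩
        x * a + 1# * 1# * (b - x * a)              ≈⟨ +-congˡ (trans (*-congʳ (*-identityˡ 1#)) (*-identityˡ _)) ⟩
        x * a + (b - x * a)                        ≈⟨ +-comm (x * a) (b - x * a) ⟩
        b - x * a + x * a                          ≈⟨ //-rightDividesˡ (x * a) b ⟩
        b                                          ∎)
        where
        regroup = solve 5 (λ Q⁻¹ Q S S⁻¹ y → Q⁻¹ :* S :* (y :* Q :* S⁻¹) := Q⁻¹ :* Q :* (S :* S⁻¹) :* y) refl

    f-solves : Solves x (λ m → zpow q q⁻¹ m * S) (λ m → f q m x S S⁻¹)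
    f-solves (+ n)      = refl
    f-solves -[1+ k ]   = begin
      f q (ℤ.suc (ℤ.suc -[1+ k ])) x S S⁻¹  ≡⟨ f-suc-suc-neg k ⟩
      b                                      ≈⟨ backward (pow-inverse (trans (*-comm q⁻¹ q) qq⁻¹≈1) (suc k)) a b ⟩
      x * a + t                              ≡⟨ Eq.cong (λ y → x * y + t) (f-suc-neg k) ⟨
      x * f q (ℤ.suc -[1+ k ]) x S S⁻¹ + t   ∎
      where
      t = zpow q q⁻¹ -[1+ k ] * S * f q -[1+ k ] x S S⁻¹
      a = proj₁ (fNeg q x S S⁻¹ k)
      b = proj₂ (fNeg q x S S⁻¹ k)

  [x-y]+[z-w]≈[x+z]-[y+w] : ∀ x y z w → (x - y) + (z - w) ≈ (x + z) - (y + w)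
  [x-y]+[z-w]≈[x+z]-[y+w] x y z w = trans (interchange x (- y) z (- w)) (+-congˡ (-‿+-comm y w))

  x+w≈y+z⇒x-y≈z-w : ∀ {x y z w} → x + w ≈ y + z → x - y ≈ z - w
  x+w≈y+z⇒x-y≈z-w {x} {y} {z} {w} x+w≈y+z = begin
    x - y                ≈⟨ +-identityʳ (x - y) ⟨
    (x - y) + 0#         ≈⟨ +-congˡ (-‿inverseʳ w) ⟨
    (x - y) + (w - w)    ≈⟨ [x-y]+[z-w]≈[x+z]-[y+w] x y w w ⟩
    (x + w) - (y + w)    ≈⟨ +-congʳ x+w≈y+z ⟩
    (y + z) - (y + w)    ≈⟨ [x-y]+[z-w]≈[x+z]-[y+w] y y z w ⟨
    (y - y) + (z - w)    ≈⟨ +-congʳ (-‿inverseʳ y) ⟩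
    0# + (z - w)         ≈⟨ +-identityˡ (z - w) ⟩
    z - w                ∎

  -x*[y-z]≈xz-xy : ∀ x y z → - x * (y - z) ≈ x * z - x * y
  -x*[y-z]≈xz-xy x y z = begin
    - x * (y - z)        ≈⟨ -‿distribˡ-* x (y - z) ⟨
    - (x * (y - z))      ≈⟨ -‿cong (x[y-z]≈xy-xz x y z) ⟩
    - (x * y - x * z)    ≈⟨ ⁻¹-anti-homo‿- (x * y) (x * z) ⟩
    x * z - x * y        ∎

  x+kx′≈y+ky′⇒x-y≈-k[x′-y′] : ∀ {x y x′ y′} k → x + k * x′ ≈ y + k * y′ → x - y ≈ - k * (x′ - y′)
  x+kx′≈y+ky′⇒x-y≈-k[x′-y′] {x′ = x′} {y′} k eq =
    trans (x+w≈y+z⇒x-y≈z-w eq) (sym (-x*[y-z]≈xz-xy k x′ y′))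

  -1*-1≈1 : - 1# * - 1# ≈ 1#
  -1*-1≈1 = trans (-1*x≈-x (- 1#)) (-‿involutive 1#)

  det3⁺ det3⁻ : (a b c d e g h i j : Carrier) → Carrier
  det3⁺ a b c d e g h i j = a * (e * j) + b * (g * h) + c * (d * i)
  det3⁻ a b c d e g h i j = a * (g * i) + b * (d * j) + c * (e * h)

  det3≈det3⁺-det3⁻ : ∀ a b c d e g h i j →
                     det3 a b c d e g h i j ≈ det3⁺ a b c d e g h i j - det3⁻ a b c d e g h i j
  det3≈det3⁺-det3⁻ a b c d e g h i j = begin
    a * (e * j - g * i) - b * (d * j - g * h) + c * (d * i - e * h)
      ≈⟨ +-cong (+-cong (x[y-z]≈xy-xz a (e * j) (g * i))
                        (trans (-‿cong (x[y-z]≈xy-xz b (d * j) (g * h))) (⁻¹-anti-homo‿- _ _)))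
                (x[y-z]≈xy-xz c (d * i) (e * h)) ⟩
    (a * (e * j) - a * (g * i)) + (b * (g * h) - b * (d * j)) + (c * (d * i) - c * (e * h))
      ≈⟨ +-congʳ ([x-y]+[z-w]≈[x+z]-[y+w] _ _ _ _) ⟩
    (a * (e * j) + b * (g * h) - (a * (g * i) + b * (d * j))) + (c * (d * i) - c * (e * h))
      ≈⟨ [x-y]+[z-w]≈[x+z]-[y+w] _ _ _ _ ⟩
    det3⁺ a b c d e g h i j - det3⁻ a b c d e g h i j
      ∎

  det3-cong : ∀ {a b c d e g h i j a′ b′ c′ d′ e′ g′ h′ i′ j′} →
              a ≈ a′ → b ≈ b′ → c ≈ c′ → d ≈ d′ → e ≈ e′ → g ≈ g′ → h ≈ h′ → i ≈ i′ → j ≈ j′ →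
              det3 a b c d e g h i j ≈ det3 a′ b′ c′ d′ e′ g′ h′ i′ j′
  det3-cong a b c d e g h i j =
    +-cong (+-cong (*-cong a (+-cong (*-cong e j) (-‿cong (*-cong g i))))
                   (-‿cong (*-cong b (+-cong (*-cong d j) (-‿cong (*-cong g h))))))
           (*-cong c (+-cong (*-cong d i) (-‿cong (*-cong e h))))

  sq-cong : ∀ {a b} → a ≈ b → sq a ≈ sq b
  sq-cong a≈b = *-cong a≈b a≈b

  sqCasoratian-identity : ∀ x α β u₀ u₁ u₂ v₀ v₁ v₂ →
    let w₀ = x * v₀ + α * u₀ ; w₁ = x * v₁ + α * u₁ ; w₂ = x * v₂ + α * u₂ in
    det3 (sq v₀) (sq v₁) (sq v₂) (sq w₀) (sq w₁) (sq w₂)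
         (sq (x * w₀ + β * v₀)) (sq (x * w₁ + β * v₁)) (sq (x * w₂ + β * v₂))
      ≈ - (β * α * α) * det3 (sq u₀) (sq u₁) (sq u₂) (sq v₀) (sq v₁) (sq v₂) (sq w₀) (sq w₁) (sq w₂)
  sqCasoratian-identity x α β u₀ u₁ u₂ v₀ v₁ v₂ =
    trans (det3≈det3⁺-det3⁻ _ _ _ _ _ _ _ _ _)
      (trans (x+kx′≈y+ky′⇒x-y≈-k[x′-y′] (β * α * α) (polynomial-identity x α β u₀ u₁ u₂ v₀ v₁ v₂))
             (*-congˡ (sym (det3≈det3⁺-det3⁻ _ _ _ _ _ _ _ _ _))))
    where
    -- The solver only has natural-number coefficients, hence the negative
    -- Leibniz terms are moved to the other side.
    polynomial-identity = solve 9 (λ x α β u₀ u₁ u₂ v₀ v₁ v₂ →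
      let D⁺ = λ a b c d e g h i j → a :* a :* (e :* e :* (j :* j)) :+ b :* b :* (g :* g :* (h :* h))
                                       :+ c :* c :* (d :* d :* (i :* i))
          D⁻ = λ a b c d e g h i j → a :* a :* (g :* g :* (i :* i)) :+ b :* b :* (d :* d :* (j :* j))
                                       :+ c :* c :* (e :* e :* (h :* h))
          w₀ = x :* v₀ :+ α :* u₀ ; w₁ = x :* v₁ :+ α :* u₁ ; w₂ = x :* v₂ :+ α :* u₂
          z₀ = x :* w₀ :+ β :* v₀ ; z₁ = x :* w₁ :+ β :* v₁ ; z₂ = x :* w₂ :+ β :* v₂
          κ = β :* α :* α
      in D⁺ v₀ v₁ v₂ w₀ w₁ w₂ z₀ z₁ z₂ :+ κ :* D⁺ u₀ u₁ u₂ v₀ v₁ v₂ w₀ w₁ w₂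
         := D⁻ v₀ v₁ v₂ w₀ w₁ w₂ z₀ z₁ z₂ :+ κ :* D⁻ u₀ u₁ u₂ v₀ v₁ v₂ w₀ w₁ w₂)
      refl

  sqCasoratian : (y₀ y₁ y₂ : ℤ → Carrier) → ℤ → Carrier
  sqCasoratian y₀ y₁ y₂ n =
    det3 (sq (y₀ n))                   (sq (y₁ n))                   (sq (y₂ n))
         (sq (y₀ (ℤ.suc n)))           (sq (y₁ (ℤ.suc n)))           (sq (y₂ (ℤ.suc n)))
         (sq (y₀ (ℤ.suc (ℤ.suc n))))   (sq (y₁ (ℤ.suc (ℤ.suc n))))   (sq (y₂ (ℤ.suc (ℤ.suc n))))

  sqCasoratian-suc : ∀ {x τ y₀ y₁ y₂} → Solves x τ y₀ → Solves x τ y₁ → Solves x τ y₂ →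
    ∀ n → sqCasoratian y₀ y₁ y₂ (ℤ.suc n) ≈ - (τ (ℤ.suc n) * τ n * τ n) * sqCasoratian y₀ y₁ y₂ n
  sqCasoratian-suc {x} {τ} {y₀} {y₁} {y₂} s₀ s₁ s₂ n = begin
    sqCasoratian y₀ y₁ y₂ (ℤ.suc n)
      ≈⟨ det3-cong refl refl refl (sq-cong (s₀ n)) (sq-cong (s₁ n)) (sq-cong (s₂ n))
                   (sq-cong (third s₀)) (sq-cong (third s₁)) (sq-cong (third s₂)) ⟩
    _ ≈⟨ sqCasoratian-identity x (τ n) (τ (ℤ.suc n)) (y₀ n) (y₁ n) (y₂ n)
                                 (y₀ (ℤ.suc n)) (y₁ (ℤ.suc n)) (y₂ (ℤ.suc n)) ⟩
    _ ≈⟨ *-congˡ (det3-cong refl refl refl refl refl refl (sq-cong (s₀ n)) (sq-cong (s₁ n)) (sq-cong (s₂ n))) ⟨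
    - (τ (ℤ.suc n) * τ n * τ n) * sqCasoratian y₀ y₁ y₂ n
      ∎
    where
    third : ∀ {y} → Solves x τ y →
            y (ℤ.suc (ℤ.suc (ℤ.suc n))) ≈ x * (x * y (ℤ.suc n) + τ n * y n) + τ (ℤ.suc n) * y (ℤ.suc n)
    third s = trans (s (ℤ.suc n)) (+-congʳ (*-congˡ (s n)))

  -- The left-hand sides below are the definition of f unfolded.
  module _ (q x : Carrier) where

    f-two : ∀ S S⁻¹ → f q (+ 2) x S S⁻¹ ≈ x
    f-two S _ = solve 2 (λ x S → x :* con 1 :+ con 1 :* S :* con 0 := x) refl x S

    f-three : ∀ S S⁻¹ → f q (+ 3) x S S⁻¹ ≈ x * x + q * S
    f-three S _ = solve 3 (λ x q S →
      x :* (x :* con 1 :+ con 1 :* S :* con 0) :+ q :* con 1 :* S :* con 1 := x :* x :+ q :* S) refl x q S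

    f-four : ∀ S S⁻¹ → f q (+ 4) x S S⁻¹ ≈ x * (x * x + q * S) + q * q * S * x
    f-four S _ = solve 3 (λ x q S →
      x :* (x :* (x :* con 1 :+ con 1 :* S :* con 0) :+ q :* con 1 :* S :* con 1)
        :+ q :* (q :* con 1) :* S :* (x :* con 1 :+ con 1 :* S :* con 0)
      := x :* (x :* x :+ q :* S) :+ q :* q :* S :* x) refl x q S

  module Determinant (q q⁻¹ s s⁻¹ x : Carrier) (qq⁻¹≈1 : q * q⁻¹ ≈ 1#) (ss⁻¹≈1 : s * s⁻¹ ≈ 1#) where

    Δ : ℤ → Carrier
    Δ n = det3
      (sq (f q n x s s⁻¹))
      (sq (f q (n ℤ.- + 1) x (q * s) (q⁻¹ * s⁻¹)))
      (sq (f q (n ℤ.- + 2) x (q * q * s) (q⁻¹ * q⁻¹ * s⁻¹)))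
      (sq (f q (n ℤ.+ + 1) x s s⁻¹))
      (sq (f q n x (q * s) (q⁻¹ * s⁻¹)))
      (sq (f q (n ℤ.- + 1) x (q * q * s) (q⁻¹ * q⁻¹ * s⁻¹)))
      (sq (f q (n ℤ.+ + 2) x s s⁻¹))
      (sq (f q (n ℤ.+ + 1) x (q * s) (q⁻¹ * s⁻¹)))
      (sq (f q n x (q * q * s) (q⁻¹ * q⁻¹ * s⁻¹)))

    ρ : ℤ → Carrier
    ρ n = (1# + 1#) * zpow (- 1#) (- 1#) n * sq x
            * zpow s s⁻¹ (+ 3 ℤ.* n ℤ.- + 4)
            * zpow q q⁻¹ (((n ℤ.+ + 1) ℤ.* (+ 3 ℤ.* n ℤ.- + 4)) / (+ 2))

    Z : ℤ → Carrier
    Z = zpow q q⁻¹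

    τ : ℤ → Carrier
    τ m = Z m * s

    col₀ col₁ col₂ : ℤ → Carrier
    col₀ m = f q m x s s⁻¹
    col₁ m = f q (m ℤ.- + 1) x (q * s) (q⁻¹ * s⁻¹)
    col₂ m = f q (m ℤ.- + 2) x (q * q * s) (q⁻¹ * q⁻¹ * s⁻¹)

    col₀-solves : Solves x τ col₀
    col₀-solves = f-solves x qq⁻¹≈1 ss⁻¹≈1

    shift-coeff : ∀ S m → Z (m ℤ.- + 1) * (q * S) ≈ Z m * S
    shift-coeff S m = trans (sym (*-assoc _ q S)) (*-congʳ (zpow-pred qq⁻¹≈1 m))

    col₁-solves : Solves x τ col₁
    col₁-solves = Solves-coeff (shift-coeff s)
      (Solves-shift (ℤ.- + 1) (f-solves x qq⁻¹≈1 (*-inverse qq⁻¹≈1 ss⁻¹≈1)))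

    col₂-solves : Solves x τ col₂
    col₂-solves = Solves-coeff coeff
      (Solves-shift (ℤ.- + 2) (f-solves x qq⁻¹≈1 (*-inverse (*-inverse qq⁻¹≈1 qq⁻¹≈1) ss⁻¹≈1)))
      where
      i-2≡i-1-1 : ∀ i → i ℤ.- + 2 ≡ i ℤ.- + 1 ℤ.- + 1
      i-2≡i-1-1 = solve-∀
      coeff : ∀ m → Z (m ℤ.- + 2) * (q * q * s) ≈ τ m
      coeff m = begin
        Z (m ℤ.- + 2) * (q * q * s)           ≈⟨ *-congˡ (*-assoc q q s) ⟩
        Z (m ℤ.- + 2) * (q * (q * s))         ≡⟨ Eq.cong (λ i → Z i * (q * (q * s))) (i-2≡i-1-1 m) ⟩
        Z (m ℤ.- + 1 ℤ.- + 1) * (q * (q * s)) ≈⟨ shift-coeff (q * s) (m ℤ.- + 1) ⟩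
        Z (m ℤ.- + 1) * (q * s)               ≈⟨ shift-coeff s m ⟩
        τ m                                   ∎

    Δ≈sqCasoratian : ∀ n → Δ n ≈ sqCasoratian col₀ col₁ col₂ n
    Δ≈sqCasoratian n = det3-cong refl refl refl
      (entry (i+1≡suc[i] n)) (entry (i≡suc[i]-1 n)) (entry (i-1≡suc[i]-2 n))
      (entry (i+2≡suc[suc[i]] n)) (entry (i+1≡suc[suc[i]]-1 n)) (entry (i≡suc[suc[i]]-2 n))
      where
      entry : ∀ {S S⁻¹ i j} → i ≡ j → sq (f q i x S S⁻¹) ≈ sq (f q j x S S⁻¹)
      entry i≡j = reflexive (Eq.cong (λ i → sq (f q i x _ _)) i≡j)
      i+1≡suc[i] : ∀ i → i ℤ.+ + 1 ≡ + 1 ℤ.+ i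
      i+1≡suc[i] = solve-∀
      i≡suc[i]-1 : ∀ i → i ≡ + 1 ℤ.+ i ℤ.- + 1
      i≡suc[i]-1 = solve-∀
      i-1≡suc[i]-2 : ∀ i → i ℤ.- + 1 ≡ + 1 ℤ.+ i ℤ.- + 2
      i-1≡suc[i]-2 = solve-∀
      i+2≡suc[suc[i]] : ∀ i → i ℤ.+ + 2 ≡ + 1 ℤ.+ (+ 1 ℤ.+ i)
      i+2≡suc[suc[i]] = solve-∀
      i+1≡suc[suc[i]]-1 : ∀ i → i ℤ.+ + 1 ≡ + 1 ℤ.+ (+ 1 ℤ.+ i) ℤ.- + 1
      i+1≡suc[suc[i]]-1 = solve-∀
      i≡suc[suc[i]]-2 : ∀ i → i ≡ + 1 ℤ.+ (+ 1 ℤ.+ i) ℤ.- + 2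
      i≡suc[suc[i]]-2 = solve-∀

    κ : ℤ → Carrier
    κ i = - (τ (ℤ.suc i) * τ i * τ i)

    κ-unit : ∀ i → IsUnit (κ i)
    κ-unit i = -‿unit (*-unit (*-unit (τ-unit (ℤ.suc i)) (τ-unit i)) (τ-unit i))
      where
      τ-unit : ∀ i → IsUnit (τ i)
      τ-unit i = *-unit (zpow-unit qq⁻¹≈1 i) (s⁻¹ , ss⁻¹≈1)

    sign-suc : ∀ n → zpow (- 1#) (- 1#) (ℤ.suc n) ≈ - 1# * zpow (- 1#) (- 1#) n
    sign-suc = zpow-suc -1*-1≈1

    s-power-suc : ∀ n → let k = + 3 ℤ.* n ℤ.- + 4 in
                  zpow s s⁻¹ (+ 3 ℤ.* ℤ.suc n ℤ.- + 4) ≈ s * (s * (s * zpow s s⁻¹ k))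
    s-power-suc n = begin
      zpow s s⁻¹ (+ 3 ℤ.* ℤ.suc n ℤ.- + 4)          ≡⟨ Eq.cong (zpow s s⁻¹) (3[1+i]-4≡3+[3i-4] n) ⟩
      zpow s s⁻¹ (ℤ.suc (ℤ.suc (ℤ.suc k)))          ≈⟨ zpow-suc ss⁻¹≈1 (ℤ.suc (ℤ.suc k)) ⟩
      s * zpow s s⁻¹ (ℤ.suc (ℤ.suc k))              ≈⟨ *-congˡ (zpow-suc ss⁻¹≈1 (ℤ.suc k)) ⟩
      s * (s * zpow s s⁻¹ (ℤ.suc k))                ≈⟨ *-congˡ (*-congˡ (zpow-suc ss⁻¹≈1 k)) ⟩
      s * (s * (s * zpow s s⁻¹ k))                  ∎
      where
      k = + 3 ℤ.* n ℤ.- + 4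
      3[1+i]-4≡3+[3i-4] : ∀ i → + 3 ℤ.* (+ 1 ℤ.+ i) ℤ.- + 4
                              ≡ + 1 ℤ.+ (+ 1 ℤ.+ (+ 1 ℤ.+ (+ 3 ℤ.* i ℤ.- + 4)))
      3[1+i]-4≡3+[3i-4] = solve-∀

    q-power-suc : ∀ n → let e = ((n ℤ.+ + 1) ℤ.* (+ 3 ℤ.* n ℤ.- + 4)) / + 2 in
                  Z (((ℤ.suc n ℤ.+ + 1) ℤ.* (+ 3 ℤ.* ℤ.suc n ℤ.- + 4)) / + 2)
                    ≈ Z e * (q * (Z n * (Z n * Z n)))
    q-power-suc n = begin
      Z (((ℤ.suc n ℤ.+ + 1) ℤ.* (+ 3 ℤ.* ℤ.suc n ℤ.- + 4)) / + 2)  ≡⟨ Eq.cong Z (exponent-suc n) ⟩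
      Z (e ℤ.+ ℤ.suc (n ℤ.+ (n ℤ.+ n)))       ≈⟨ zpow-+ qq⁻¹≈1 e (ℤ.suc (n ℤ.+ (n ℤ.+ n))) ⟩
      Z e * Z (ℤ.suc (n ℤ.+ (n ℤ.+ n)))       ≈⟨ *-congˡ (zpow-suc qq⁻¹≈1 (n ℤ.+ (n ℤ.+ n))) ⟩
      Z e * (q * Z (n ℤ.+ (n ℤ.+ n)))         ≈⟨ *-congˡ (*-congˡ (zpow-+ qq⁻¹≈1 n (n ℤ.+ n))) ⟩
      Z e * (q * (Z n * Z (n ℤ.+ n)))         ≈⟨ *-congˡ (*-congˡ (*-congˡ (zpow-+ qq⁻¹≈1 n n))) ⟩
      Z e * (q * (Z n * (Z n * Z n)))         ∎
      where
      e = ((n ℤ.+ + 1) ℤ.* (+ 3 ℤ.* n ℤ.- + 4)) / + 2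

    ρ-suc : ∀ n → ρ (ℤ.suc n) ≈ κ n * ρ n
    ρ-suc n = begin
      ρ (ℤ.suc n)
        ≈⟨ *-cong (*-cong (*-congʳ (*-congˡ (sign-suc n))) (s-power-suc n)) (q-power-suc n) ⟩
      two * (- 1# * σ) * (x * x) * (s * (s * (s * S))) * (Zₑ * (q * (Z n * (Z n * Z n))))
        ≈⟨ regroup two (- 1#) σ x s S Zₑ q (Z n) ⟩
      - 1# * (q * Z n * s * (Z n * s) * (Z n * s) * ρ n)
        ≈⟨ -1*x≈-x _ ⟩
      - (q * Z n * s * (Z n * s) * (Z n * s) * ρ n)
        ≈⟨ -‿distribˡ-* _ (ρ n) ⟩
      - (q * Z n * s * (Z n * s) * (Z n * s)) * ρ n
        ≈⟨ *-congʳ (-‿cong (*-congʳ (*-congʳ (*-congʳ (zpow-suc qq⁻¹≈1 n))))) ⟨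
      κ n * ρ n
        ∎
      where
      two = 1# + 1#
      σ = zpow (- 1#) (- 1#) n
      S = zpow s s⁻¹ (+ 3 ℤ.* n ℤ.- + 4)
      Zₑ = Z (((n ℤ.+ + 1) ℤ.* (+ 3 ℤ.* n ℤ.- + 4)) / + 2)
      regroup = solve 9 (λ two m σ x s S Zₑ q Zₙ →
        two :* (m :* σ) :* (x :* x) :* (s :* (s :* (s :* S))) :* (Zₑ :* (q :* (Zₙ :* (Zₙ :* Zₙ))))
        := m :* (q :* Zₙ :* s :* (Zₙ :* s) :* (Zₙ :* s) :* (two :* σ :* (x :* x) :* S :* Zₑ))) refl

    sqCasoratian-two : sqCasoratian col₀ col₁ col₂ (+ 2) ≈ ρ (+ 2)
    sqCasoratian-two = begin
      sqCasoratian col₀ col₁ col₂ (+ 2)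
        ≈⟨ det3-cong (sq-cong (f-two q x s s⁻¹)) refl refl
                     (sq-cong (f-three q x s s⁻¹)) (sq-cong (f-two q x (q * s) (q⁻¹ * s⁻¹))) refl
                     (sq-cong (f-four q x s s⁻¹)) (sq-cong (f-three q x (q * s) (q⁻¹ * s⁻¹)))
                     (sq-cong (f-two q x (q * q * s) (q⁻¹ * q⁻¹ * s⁻¹))) ⟩
      det3 a b c d e g h i j
        ≈⟨ det3≈det3⁺-det3⁻ a b c d e g h i j ⟩
      det3⁺ a b c d e g h i j - det3⁻ a b c d e g h i j
        ≈⟨ x≈z//y K _ _ (polynomial-identity x q s) ⟨
      K
        ≈⟨ *-congʳ (*-congʳ (*-congʳ (*-congˡ (sym (trans (*-congˡ (*-identityʳ (- 1#))) -1*-1≈1))))) ⟩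
      ρ (+ 2)
        ∎
      where
      a = sq x ; b = sq 1# ; c = sq 0#
      d = sq (x * x + q * s) ; e = sq x ; g = sq 1#
      h = sq (x * (x * x + q * s) + q * q * s * x) ; i = sq (x * x + q * (q * s)) ; j = sq x
      K = (1# + 1#) * 1# * sq x * (s * (s * 1#)) * (q * (q * (q * 1#)))
      polynomial-identity = solve 3 (λ x q s →
        let D⁺ = λ a b c d e g h i j → a :* a :* (e :* e :* (j :* j)) :+ b :* b :* (g :* g :* (h :* h))
                                         :+ c :* c :* (d :* d :* (i :* i))
            D⁻ = λ a b c d e g h i j → a :* a :* (g :* g :* (i :* i)) :+ b :* b :* (d :* d :* (j :* j))
                                         :+ c :* c :* (e :* e :* (h :* h))
            F₃ = λ S → x :* x :+ q :* S
            F₄ = x :* F₃ s :+ q :* q :* s :* x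
        in (con 1 :+ con 1) :* con 1 :* (x :* x) :* (s :* (s :* con 1)) :* (q :* (q :* (q :* con 1)))
             :+ D⁻ x (con 1) (con 0) (F₃ s) x (con 1) F₄ (F₃ (q :* s)) x
           := D⁺ x (con 1) (con 0) (F₃ s) x (con 1) F₄ (F₃ (q :* s)) x) refl

    theorem : ∀ n → Δ n ≈ ρ n
    theorem n = begin
      Δ n                             ≈⟨ Δ≈sqCasoratian n ⟩
      sqCasoratian col₀ col₁ col₂ n   ≈⟨ same-ratio⇒≈ κ-unit
                                           (sqCasoratian-suc col₀-solves col₁-solves col₂-solves)
                                           ρ-suc (+ 2) sqCasoratian-two n ⟩
      ρ n                             ∎

mainTheorem6 : {c ℓ : Level} (R : CommutativeRing c ℓ) →
  let open CommutativeRing R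
      open QFib R
  in (q qi s si x : Carrier) → q * qi ≈ 1# → s * si ≈ 1# → (n : ℤ) →
     det3
       (sq (f q n x s si))
       (sq (f q (n ℤ.- + 1) x (q * s) (qi * si)))
       (sq (f q (n ℤ.- + 2) x (q * q * s) (qi * qi * si)))
       (sq (f q (n ℤ.+ + 1) x s si))
       (sq (f q n x (q * s) (qi * si)))
       (sq (f q (n ℤ.- + 1) x (q * q * s) (qi * qi * si)))
       (sq (f q (n ℤ.+ + 2) x s si))
       (sq (f q (n ℤ.+ + 1) x (q * s) (qi * si)))
       (sq (f q n x (q * q * s) (qi * qi * si)))
     ≈ (1# + 1#) * zpow (- 1#) (- 1#) n * sq x
         * zpow s si (+ 3 ℤ.* n ℤ.- + 4)
         * zpow q qi (((n ℤ.+ + 1) ℤ.* (+ 3 ℤ.* n ℤ.- + 4)) / (+ 2))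
mainTheorem6 R q qi s si x qqi≈1 ssi≈1 = Determinant.theorem R q qi s si x qqi≈1 ssi≈1
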